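{- Suppose $\mathcal{U}$ is a p-point on $\omega$ and $\mathcal{V}$ is an arbitrary ultrafilter on $\omega$ with $\mathcal{U}\ge_T\mathcal{V}$. Then there is a continuous monotone map $f^*:\mathcal{P}(\omega)\to\mathcal{P}(\omega)$ whose restriction to $\mathcal{U}$ is continuous and has range contained in and cofinal in $(\mathcal{V},\supseteq)$. Hence there is a continuous monotone cofinal map from $\mathcal{U}$ into $\mathcal{V}$ witnessing $\mathcal{U}\ge_T\mathcal{V}$.
   Context: Ultrafilters are ordered by reverse inclusion $\supseteq$. $\mathcal{U}\ge_T\mathcal{V}$ means there is a map $f:\mathcal{U}\to\mathcal{V}$ sending every cofinal subset of $(\mathcal{U},\supseteq)$ to a cofinal subset of $(\mathcal{V},\supseteq)$ (a cofinal map). A map $f$ between families of sets is monotone if $X\subseteq Y$ implies $f(X)\subseteq f(Y)$. $\mathcal{P}(\omega)$ carries the Cantor space topology (identifying sets with characteristic functions), and subsets of it the subspace topology. A p-point is a nonprincipal ultrafilter $\mathcal{U}$ on $\omega$ such that for every $\{X_n:n<\omega\}\subseteq\mathcal{U}$ there is $X\in\mathcal{U}$ with $X\setminus X_n$ finite for all $n$. -}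

module Defs where

open import Data.Nat using (ℕ; _≤_; _<_; _≟_)
open import Data.Bool using (Bool; true; false; not; _∧_)
open import Data.Product using (Σ; _×_; _,_)
open import Data.Sum using (_⊎_)
open import Relation.Nullary using (¬_; does)
open import Relation.Binary.PropositionalEquality using (_≡_)

PSet : Set
PSet = ℕ → Bool

Family : Set₁
Family = PSet → Set

_∈ₛ_ : ℕ → PSet → Set
n ∈ₛ X = X n ≡ true

_⊆_ : PSet → PSet → Set
X ⊆ Y = ∀ n → n ∈ₛ X → n ∈ₛ Y

_⊆*_ : PSet → PSet → Set
X ⊆* Y = Σ ℕ λ N → ∀ n → N ≤ n → n ∈ₛ X → n ∈ₛ Y

_∩_ : PSet → PSet → PSet
(X ∩ Y) n = X n ∧ Y n

ω : PSet
ω _ = true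

∅ : PSet
∅ _ = false

compl : PSet → PSet
compl X n = not (X n)

singleton : ℕ → PSet
singleton m n = does (m ≟ n)

record Ultrafilter (U : Family) : Set where
  field
    upward   : ∀ X Y → U X → X ⊆ Y → U Y
    inter    : ∀ X Y → U X → U Y → U (X ∩ Y)
    hasω     : U ω
    proper   : ¬ U ∅
    ultra    : ∀ X → U X ⊎ U (compl X)

Nonprincipal : Family → Set
Nonprincipal U = ∀ n → ¬ U (singleton n)

record PPoint (U : Family) : Set where
  field
    ultrafilter  : Ultrafilter U
    nonprincipal : Nonprincipal U
    pseudoint    : (S : ℕ → PSet) → (∀ n → U (S n)) →
                   Σ PSet λ X → U X × (∀ n → X ⊆* S n)

CofinalIn : Family → Family → Set
CofinalIn C U = (∀ X → C X → U X) × (∀ X → U X → Σ PSet λ Y → C Y × Y ⊆ X)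

-- The image f[C] is cofinal in (V, ⊇)  (f[C] ⊆ V is required separately)
ImageCofinal : (PSet → PSet) → Family → Family → Set
ImageCofinal f C V = ∀ Z → V Z → Σ PSet λ Y → C Y × f Y ⊆ Z

CofinalMap : (PSet → PSet) → Family → Family → Set₁
CofinalMap f U V = (∀ X → U X → V (f X)) ×
                   ((C : Family) → CofinalIn C U → ImageCofinal f C V)

_≥T_ : Family → Family → Set₁
U ≥T V = Σ (PSet → PSet) λ g → CofinalMap g U V

Monotone : (PSet → PSet) → Set
Monotone f = ∀ X Y → X ⊆ Y → f X ⊆ f Y

AgreeBelow : ℕ → PSet → PSet → Set
AgreeBelow m X Y = ∀ k → k < m → X k ≡ Y k

-- continuity of f : P(ω) → P(ω) (Cantor topology): each output bit depends
-- on finitely many input bits, locally around each point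
Continuous : (PSet → PSet) → Set
Continuous f = ∀ X n → Σ ℕ λ m → ∀ Y → AgreeBelow m X Y → f X n ≡ f Y n

ContinuousOn : (PSet → PSet) → Family → Set
ContinuousOn f U = ∀ X → U X → ∀ n → Σ ℕ λ m → ∀ Y → U Y → AgreeBelow m X Y → f X n ≡ f Y n

module Submission where

-- Let g witness U ≥_T V.  The proof has three layers.
--   1. The downward hull  h X = ⋃ { g W : W ∈ U, W ⊆ X }  is monotone, maps
--      U into V and has range cofinal in V; only the last point uses that g is
--      a cofinal map (the sets of U whose g-image escapes a given Z ∈ V cannot
--      be cofinal in U).
--   2. Continuity is forced by the p-point property.  For a cut c, a bit n < c
--      and a prefix pattern v ∈ 2^c, choose W ∈ U such that, if some tail from
--      U glued onto v keeps n out of h, then W does; the finite intersection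
--      of these choices is the "stable" set for c.  A pseudo-intersection X₀
--      lies in stable c beyond some N c, and splitting ω into the intervals of
--      a sequence jumping past N yields a set S ⊆ X₀ in U together with cuts
--      c n > n such that S has no elements in [c n, N (c n)).
--   3. f* X n = h (X below c n, glued onto S from c n on) n.  Bit n depends
--      only on X below c n, f* is monotone, maps U into V, and its range is
--      still cofinal because S is stable above c n.  Monotone maps with
--      cofinal range are cofinal maps, which finishes theorem20.

open import Defs
open import Level using (0ℓ)
open import Axiom.ExcludedMiddle using (ExcludedMiddle)
open import Axiom.DoubleNegationElimination using (em⇒dne)
open import Function using (_∘_)
open import Data.Product using (Σ; _×_; _,_; proj₁; proj₂)
open import Data.Sum using (inj₁; inj₂)
open import Data.Empty using (⊥-elim)
open import Data.Bool using (Bool; true; false; not)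
open import Data.Bool.Properties using (∧-conicalˡ; ∧-conicalʳ)
open import Data.Vec using (Vec; []; _∷_)
open import Data.Nat using (ℕ; zero; suc; _≤_; _<_; _*_; _⊔_; z≤n; s≤s; s≤s⁻¹; _<?_)
open import Data.Nat.Properties using (≤-refl; n≤1+n; ≤-trans; <-≤-trans; ≤-<-trans; <⇒≤; <⇒≱; ≮⇒≥; m≤m⊔n; m≤n⊔m; m≤n⇒m<n∨m≡n; m≤n*m; *-suc; *-monoʳ-≤; *-cancelˡ-<)
open import Relation.Nullary using (¬_; Dec; yes; no; does)
open import Relation.Nullary.Decidable using (dec-true)
open import Relation.Binary.PropositionalEquality using (_≡_; refl; sym; trans; subst)

∩-elimˡ : ∀ X Y {k} → k ∈ₛ (X ∩ Y) → k ∈ₛ X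
∩-elimˡ X Y {k} = ∧-conicalˡ (X k) (Y k)

∩-elimʳ : ∀ X Y {k} → k ∈ₛ (X ∩ Y) → k ∈ₛ Y
∩-elimʳ X Y {k} = ∧-conicalʳ (X k) (Y k)

not-true : ∀ {b} → b ≡ true → ¬ (not b ≡ true)
not-true refl ()

bool-ext : ∀ {a b : Bool} → (a ≡ true → b ≡ true) → (b ≡ true → a ≡ true) → a ≡ b
bool-ext {true}  {true}  _ _ = refl
bool-ext {true}  {false} a⇒b _ = sym (a⇒b refl)
bool-ext {false} {true}  _ b⇒a = b⇒a refl
bool-ext {false} {false} _ _ = refl

from-does : {P : Set} (d : Dec P) → does d ≡ true → P
from-does (yes p) _ = p

-- A monotone map on P(ω) sends pointwise equal sets to equal sets; this is
-- what turns "f X n depends on finitely many bits of X" into continuity.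
monotone-respects : ∀ f → Monotone f → ∀ {A B} → (∀ k → A k ≡ B k) → ∀ n → f A n ≡ f B n
monotone-respects f mono {A} {B} A≗B n =
  bool-ext (mono A B (λ k → trans (sym (A≗B k))) n) (mono B A (λ k → trans (A≗B k)) n)

splice : ℕ → PSet → PSet → PSet
splice c A B k with k <? c
... | yes _ = A k
... | no  _ = B k

splice-mono : ∀ c {A A' B B'} → (∀ k → k < c → k ∈ₛ A → k ∈ₛ A') →
              (∀ k → c ≤ k → k ∈ₛ B → k ∈ₛ B') → splice c A B ⊆ splice c A' B'
splice-mono c below above k with k <? c
... | yes k<c = below k k<c
... | no  k≮c = above k (≮⇒≥ k≮c)

splice-⊆ : ∀ c {A B Z} → A ⊆ Z → B ⊆ Z → splice c A B ⊆ Z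
splice-⊆ c A⊆Z B⊆Z k with k <? c
... | yes _ = A⊆Z k
... | no  _ = B⊆Z k

∩-⊆-splice : ∀ c A B → (A ∩ B) ⊆ splice c A B
∩-⊆-splice c A B k with k <? c
... | yes _ = ∩-elimˡ A B
... | no  _ = ∩-elimʳ A B

splice-agree : ∀ {c A A'} B → AgreeBelow c A A' → ∀ k → splice c A B k ≡ splice c A' B k
splice-agree {c} B agree k with k <? c
... | yes k<c = agree k k<c
... | no  _   = refl

toSet : ∀ {c} → Vec Bool c → PSet
toSet []      _       = false
toSet (b ∷ v) zero    = b
toSet (b ∷ v) (suc k) = toSet v k

prefix : (c : ℕ) → PSet → Vec Bool c
prefix zero    X = []
prefix (suc c) X = X zero ∷ prefix c (λ k → X (suc k))

toSet-prefix : ∀ c X {k} → k < c → toSet (prefix c X) k ≡ X k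
toSet-prefix (suc c) X {zero}  _   = refl
toSet-prefix (suc c) X {suc k} k<c = toSet-prefix c (λ i → X (suc i)) (s≤s⁻¹ k<c)

⋂ᵥ : (c : ℕ) → (Vec Bool c → PSet) → PSet
⋂ᵥ zero    F = F []
⋂ᵥ (suc c) F = ⋂ᵥ c (λ v → F (true ∷ v)) ∩ ⋂ᵥ c (λ v → F (false ∷ v))

∈-⋂ᵥ : ∀ c F {k} → k ∈ₛ ⋂ᵥ c F → ∀ v → k ∈ₛ F v
∈-⋂ᵥ zero    F k∈ [] = k∈
∈-⋂ᵥ (suc c) F k∈ (true ∷ v)  = ∈-⋂ᵥ c _ (∩-elimˡ (⋂ᵥ c _) (⋂ᵥ c _) k∈) v
∈-⋂ᵥ (suc c) F k∈ (false ∷ v) = ∈-⋂ᵥ c _ (∩-elimʳ (⋂ᵥ c _) (⋂ᵥ c _) k∈) v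

⋂< : ℕ → (ℕ → PSet) → PSet
⋂< zero    G = ω
⋂< (suc c) G = ⋂< c G ∩ G c

∈-⋂< : ∀ c G {k} → k ∈ₛ ⋂< c G → ∀ n → n < c → k ∈ₛ G n
∈-⋂< (suc c) G k∈ n n<1+c with m≤n⇒m<n∨m≡n (s≤s⁻¹ n<1+c)
... | inj₁ n<c  = ∈-⋂< c G (∩-elimˡ (⋂< c G) (G c) k∈) n n<c
... | inj₂ refl = ∩-elimʳ (⋂< c G) (G c) k∈

module _ {U : Family} (uU : Ultrafilter U) where
  open Ultrafilter uU using (inter; hasω)

  U-⋂ᵥ : ∀ c F → (∀ v → U (F v)) → U (⋂ᵥ c F)
  U-⋂ᵥ zero    F uF = uF []
  U-⋂ᵥ (suc c) F uF =
    inter _ _ (U-⋂ᵥ c _ (λ v → uF (true ∷ v))) (U-⋂ᵥ c _ (λ v → uF (false ∷ v)))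

  U-⋂< : ∀ c G → (∀ n → U (G n)) → U (⋂< c G)
  U-⋂< zero    G uG = hasω
  U-⋂< (suc c) G uG = inter _ _ (U-⋂< c G uG) (uG c)

best-in : ExcludedMiddle 0ℓ → {U : Family} → U ω → (P : PSet → Set) →
          Σ PSet λ W → U W × ((Σ PSet λ Y → U Y × P Y) → P W)
best-in lem hasω P with lem {Σ PSet λ Y → _ × P Y}
... | yes (Y , uY , pY) = Y , uY , λ _ → pY
... | no  none          = ω , hasω , λ some → ⊥-elim (none some)

continuous⇒continuousOn : ∀ f {U} → Continuous f → ContinuousOn f U
continuous⇒continuousOn f cont X _ n =
  let (m , agree⇒eq) = cont X n in m , λ Y _ → agree⇒eq Y

-- A monotone map sending U into V with range cofinal in V is a cofinal map:
-- below the preimage X of Z there is an element of any cofinal C ⊆ U.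
monotone-cofinal : ∀ f {U V} → Monotone f → (∀ X → U X → V (f X)) →
                   (∀ Z → V Z → Σ PSet λ X → U X × f X ⊆ Z) → CofinalMap f U V
monotone-cofinal f mono inV cof = inV , λ C (_ , C-cofinal) Z vZ →
  let (X , uX , fX⊆Z) = cof Z vZ
      (Y , cY , Y⊆X)  = C-cofinal X uX
  in Y , cY , λ n n∈fY → fX⊆Z n (mono Y X Y⊆X n n∈fY)

stepwise-mono : (a : ℕ → ℕ) → (∀ i → a i ≤ a (suc i)) → ∀ {i j} → i ≤ j → a i ≤ a j
stepwise-mono a step {j = zero}  z≤n = ≤-refl
stepwise-mono a step {j = suc j} i≤1+j with m≤n⇒m<n∨m≡n i≤1+j
... | inj₁ i<1+j = ≤-trans (stepwise-mono a step (s≤s⁻¹ i<1+j)) (step j)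
... | inj₂ refl  = ≤-refl

record Gapped (U : Family) (N : ℕ → ℕ) : Set where
  field
    set   : PSet
    inU   : U set
    cut   : ℕ → ℕ
    n<cut : ∀ n → n < cut n
    gap   : ∀ n k → k ∈ₛ set → cut n ≤ k → N (cut n) ≤ k

module Intervals (lem : ExcludedMiddle 0ℓ) (N : ℕ → ℕ) where

  jump : ℕ → ℕ
  jump zero    = 1
  jump (suc i) = suc (jump i) ⊔ N (jump i)

  jump-N : ∀ i → N (jump i) ≤ jump (suc i)
  jump-N i = m≤n⊔m (suc (jump i)) (N (jump i))

  jump-< : ∀ i → jump i < jump (suc i)
  jump-< i = m≤m⊔n (suc (jump i)) (N (jump i))

  i<jump : ∀ i → i < jump i
  i<jump zero    = s≤s z≤n
  i<jump (suc i) = <-≤-trans (s≤s (i<jump i)) (jump-< i)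

  jump-mono : ∀ {i j} → i ≤ j → jump i ≤ jump j
  jump-mono = stepwise-mono jump (λ i → <⇒≤ (jump-< i))

  jump-reflects : ∀ {i j} → jump i < jump j → i < j
  jump-reflects {i} {j} lt with i <? j
  ... | yes i<j = i<j
  ... | no  i≮j = ⊥-elim (<⇒≱ lt (jump-mono (≮⇒≥ i≮j)))

  Even : PSet
  Even k = does (lem {Σ ℕ λ j → jump (2 * j) ≤ k × k < jump (suc (2 * j))})

  -- An element of Even beyond jump (2n+1) lies in a later even interval.
  even-gapped : ∀ {U} → U Even → Gapped U N
  even-gapped uE = record
    { set = Even ; inU = uE ; cut = λ n → jump (suc (2 * n))
    ; n<cut = λ n → ≤-<-trans (≤-trans (m≤n*m n 2) (n≤1+n (2 * n))) (i<jump (suc (2 * n)))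
    ; gap = gap }
    where
      gap : ∀ n k → k ∈ₛ Even → jump (suc (2 * n)) ≤ k → N (jump (suc (2 * n))) ≤ k
      gap n k k∈E le with from-does lem k∈E
      ... | j , start≤k , k<end = ≤-trans (jump-N (suc (2 * n))) (≤-trans (jump-mono next≤2j) start≤k)
        where
          n<j : n < j
          n<j = *-cancelˡ-< 2 n j (s≤s⁻¹ (jump-reflects (≤-<-trans le k<end)))
          next≤2j : suc (suc (2 * n)) ≤ 2 * j
          next≤2j = subst (_≤ 2 * j) (*-suc 2 n) (*-monoʳ-≤ 2 n<j)

  -- An element outside Even beyond jump 2n has left the interval [jump 2n, jump (2n+1)).
  odd-gapped : ∀ {U} → U (compl Even) → Gapped U N
  odd-gapped uO = record
    { set = compl Even ; inU = uO ; cut = λ n → jump (2 * n)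
    ; n<cut = λ n → ≤-<-trans (m≤n*m n 2) (i<jump (2 * n))
    ; gap = gap }
    where
      gap : ∀ n k → k ∈ₛ compl Even → jump (2 * n) ≤ k → N (jump (2 * n)) ≤ k
      gap n k k∉E start≤k with k <? jump (suc (2 * n))
      ... | yes k<end = ⊥-elim (not-even (dec-true lem (n , start≤k , k<end)))
        where
          not-even : ¬ k ∈ₛ Even
          not-even k∈E = not-true k∈E k∉E
      ... | no  k≮end = ≤-trans (jump-N (2 * n)) (≮⇒≥ k≮end)

  gapped : ∀ {U} → Ultrafilter U → Gapped U N
  gapped uU with Ultrafilter.ultra uU Even
  ... | inj₁ uE = even-gapped uE
  ... | inj₂ uO = odd-gapped uO

module Hull (lem : ExcludedMiddle 0ℓ) {U V : Family} (g : PSet → PSet) where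

  hull : PSet → PSet
  hull X n = does (lem {Σ PSet λ W → U W × W ⊆ X × n ∈ₛ g W})

  hull-mono : Monotone hull
  hull-mono X Y X⊆Y n n∈ =
    let (W , uW , W⊆X , n∈gW) = from-does lem n∈
    in dec-true lem (W , uW , (λ k → X⊆Y k ∘ W⊆X k) , n∈gW)

  g⊆hull : ∀ {X} → U X → g X ⊆ hull X
  g⊆hull {X} uX n n∈gX = dec-true lem (X , uX , (λ _ k∈ → k∈) , n∈gX)

  -- If g is cofinal, some X ∈ U has g Y ⊆ Z for all Y ∈ U below it;
  -- otherwise the sets of U whose g-image escapes Z would be cofinal in U.
  hull-cofinal : ((C : Family) → CofinalIn C U → ImageCofinal g C V) →
                 ∀ Z → V Z → Σ PSet λ X → U X × hull X ⊆ Z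
  hull-cofinal g-cofinal Z vZ with lem {Σ PSet λ X → U X × (∀ Y → U Y → Y ⊆ X → g Y ⊆ Z)}
  ... | yes (X , uX , below⇒⊆Z) = X , uX , λ n n∈ →
          let (W , uW , W⊆X , n∈gW) = from-does lem n∈ in below⇒⊆Z W uW W⊆X n n∈gW
  ... | no none with g-cofinal Escaping escaping-cofinal Z vZ
    where
      Escaping : Family
      Escaping Y = U Y × ¬ (g Y ⊆ Z)
      escaping-cofinal : CofinalIn Escaping U
      escaping-cofinal = (λ _ → proj₁) , λ X uX → em⇒dne lem λ noneBelow →
        none (X , uX , λ Y uY Y⊆X → em⇒dne lem λ escapes → noneBelow (Y , (uY , escapes) , Y⊆X))
  ... | _ , (_ , escapes) , gY⊆Z = ⊥-elim (escapes gY⊆Z)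

module Stabiliser (lem : ExcludedMiddle 0ℓ) {U : Family} (uU : Ultrafilter U)
                  (h : PSet → PSet) (h-mono : Monotone h) where
  open Ultrafilter uU using (hasω)

  Avoidable : ℕ → ℕ → PSet → Set
  Avoidable c n A = Σ PSet λ Y → U Y × ¬ n ∈ₛ h (splice c A Y)

  best-tail : (c n : ℕ) (v : Vec Bool c) →
              Σ PSet λ W → U W × (Avoidable c n (toSet v) → ¬ n ∈ₛ h (splice c (toSet v) W))
  best-tail c n v = best-in lem hasω (λ Y → ¬ n ∈ₛ h (splice c (toSet v) Y))

  stable : ℕ → PSet
  stable c = ⋂< c (λ n → ⋂ᵥ c (λ v → proj₁ (best-tail c n v)))

  stable-∈U : ∀ c → U (stable c)
  stable-∈U c = U-⋂< uU c _ λ n → U-⋂ᵥ uU c _ λ v → proj₁ (proj₂ (best-tail c n v))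

  -- Avoidability over a prefix A is inherited by every tail eventually in stable c,
  -- since such a tail is, above c, inside the best tail for the pattern of A.
  stable-avoids : ∀ {c n} → n < c → ∀ A → Avoidable c n A →
                  ∀ Y → (∀ k → c ≤ k → k ∈ₛ Y → k ∈ₛ stable c) → ¬ n ∈ₛ h (splice c A Y)
  stable-avoids {c} {n} n<c A (Y₀ , uY₀ , n∉) Y Y-tail n∈ =
    W-avoids avoidable-on-pattern (h-mono _ _ (splice-mono c to-pattern into-W) n n∈)
    where
      v : Vec Bool c
      v = prefix c A
      W : PSet
      W = proj₁ (best-tail c n v)
      W-avoids : Avoidable c n (toSet v) → ¬ n ∈ₛ h (splice c (toSet v) W)
      W-avoids = proj₂ (proj₂ (best-tail c n v))
      to-pattern : ∀ k → k < c → k ∈ₛ A → k ∈ₛ toSet v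
      to-pattern k k<c = trans (toSet-prefix c A k<c)
      avoidable-on-pattern : Avoidable c n (toSet v)
      avoidable-on-pattern = Y₀ , uY₀ , λ n∈' → n∉ (h-mono _ _
        (splice-mono c (λ k k<c → trans (sym (toSet-prefix c A k<c))) (λ _ _ k∈ → k∈)) n n∈')
      into-W : ∀ k → c ≤ k → k ∈ₛ Y → k ∈ₛ W
      into-W k c≤k k∈Y =
        ∈-⋂ᵥ c _ (∈-⋂< c _ (Y-tail k c≤k k∈Y) n n<c) v

module Continuisation (lem : ExcludedMiddle 0ℓ) {U V : Family} (pp : PPoint U) (uV : Ultrafilter V)
       (h : PSet → PSet) (h-mono : Monotone h) (h-U : ∀ X → U X → V (h X))
       (h-cofinal : ∀ Z → V Z → Σ PSet λ X → U X × h X ⊆ Z) where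
  open PPoint pp using (ultrafilter; pseudoint)
  open Ultrafilter ultrafilter using (inter)
  open Stabiliser lem ultrafilter h h-mono

  pseudo : Σ PSet λ X → U X × (∀ c → X ⊆* stable c)
  pseudo = pseudoint stable stable-∈U

  X₀ : PSet
  X₀ = proj₁ pseudo

  N : ℕ → ℕ
  N c = proj₁ (proj₂ (proj₂ pseudo) c)

  X₀-tail : ∀ c k → N c ≤ k → k ∈ₛ X₀ → k ∈ₛ stable c
  X₀-tail c = proj₂ (proj₂ (proj₂ pseudo) c)

  open Gapped (Intervals.gapped lem N ultrafilter)

  S : PSet
  S = X₀ ∩ set

  S-∈U : U S
  S-∈U = inter _ _ (proj₁ (proj₂ pseudo)) inU

  -- Since S skips [cut n, N (cut n)), it is stable from cut n on.
  S-tail : ∀ n k → cut n ≤ k → k ∈ₛ S → k ∈ₛ stable (cut n)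
  S-tail n k cut≤k k∈S =
    X₀-tail (cut n) k (gap n k (∩-elimʳ X₀ set k∈S) cut≤k) (∩-elimˡ X₀ set k∈S)

  f* : PSet → PSet
  f* X n = h (splice (cut n) X S) n

  f*-continuous : Continuous f*
  f*-continuous X n = cut n , λ Y agree → monotone-respects h h-mono (splice-agree S agree) n

  f*-monotone : Monotone f*
  f*-monotone X Y X⊆Y n = h-mono _ _ (splice-mono (cut n) (λ k _ → X⊆Y k) (λ _ _ k∈ → k∈)) n

  f*-U : ∀ X → U X → V (f* X)
  f*-U X uX = Ultrafilter.upward uV _ _ (h-U (X ∩ S) (inter _ _ uX S-∈U))
    (λ n → h-mono _ _ (∩-⊆-splice (cut n) X S) n)

  -- For Z ∈ V pick W with h W ⊆ Z and take X = W ∩ S: for n ∉ Z the tail X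
  -- itself shows n avoidable over the prefix X, so the stable tail S avoids it.
  f*-cofinal : ∀ Z → V Z → Σ PSet λ X → U X × f* X ⊆ Z
  f*-cofinal Z vZ with h-cofinal Z vZ
  ... | W , uW , hW⊆Z = X , uX , λ n n∈ → em⇒dne lem λ n∉Z →
          stable-avoids (n<cut n) X (X , uX , X-avoids n n∉Z) S (S-tail n) n∈
    where
      X : PSet
      X = W ∩ S
      uX : U X
      uX = inter _ _ uW S-∈U
      X-avoids : ∀ n → ¬ n ∈ₛ Z → ¬ n ∈ₛ h (splice (cut n) X X)
      X-avoids n n∉Z n∈ = n∉Z (hW⊆Z n (h-mono _ _ (splice-⊆ (cut n) X⊆W X⊆W) n n∈))
        where
          X⊆W : X ⊆ W
          X⊆W k = ∩-elimˡ W S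

theorem20 : ExcludedMiddle 0ℓ → (U V : Family) → PPoint U → Ultrafilter V → U ≥T V →
    Σ (PSet → PSet) (λ f →
      (Continuous f × Monotone f × ContinuousOn f U
        × (∀ X → U X → V (f X))
        × ((Z : PSet) → V Z → Σ PSet (λ X → U X × f X ⊆ Z)))
      × CofinalMap f U V)
theorem20 lem U V pp uV (g , g-U , g-cofinal) =
  f* , (f*-continuous , f*-monotone , continuous⇒continuousOn f* f*-continuous , f*-U , f*-cofinal)
     , monotone-cofinal f* f*-monotone f*-U f*-cofinal
  where
    open Hull lem {U} {V} g
    hull-U : ∀ X → U X → V (hull X)
    hull-U X uX = Ultrafilter.upward uV _ _ (g-U X uX) (g⊆hull uX)
    open Continuisation lem pp uV hull hull-mono hull-U (hull-cofinal g-cofinal)
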